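{- Let $d\in\mathbb{N}$ and let $p_1,\dots,p_n$ be distinct points in $\mathbb{R}^d$. Color $\binom{[n]}{2}$ by $COL(i,j)=|p_i-p_j|$ (Euclidean distance). Then this coloring has no whomog set of size $d+3$.
   Context: For a coloring $COL$ of the 2-element subsets of $[n]$, a set $V\subseteq[n]$ is weakly homogeneous (whomog) if its elements can be listed in some order (not necessarily numerical) as $V=\{x_1,\dots,x_L\}$ such that for all $1\le i\le L-3$ and all $i<j<k\le L$, $COL(x_i,x_j)=COL(x_i,x_k)$. -}

module Defs where

open import Level using (0ℓ)
open import Data.Nat using (ℕ; _+_; _<_)
open import Data.Fin using (Fin; toℕ)
open import Data.Vec using (Vec; zipWith; foldr)
open import Data.Product using (Σ; ∃; _×_)
open import Relation.Binary.PropositionalEquality using (_≡_; _≢_)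
open import Relation.Binary.Structures using (IsTotalOrder)
open import Algebra.Structures using (IsCommutativeRing)
open import Relation.Nullary using (¬_)

-- An abstract model of the real numbers: a complete ordered field
-- (Dedekind-complete, via least upper bounds of bounded nonempty
-- predicates), together with a square-root operation on the
-- nonnegative elements (which exists in any complete ordered field).
-- The reals are the unique such structure up to isomorphism, so
-- quantifying over all models is quantifying over ℝ.

record Reals : Set₁ where
  infixl 6 _+ᴿ_
  infixl 7 _*ᴿ_
  infix 4 _≤ᴿ_
  field
    ℝ     : Set
    _+ᴿ_  : ℝ → ℝ → ℝ
    _*ᴿ_  : ℝ → ℝ → ℝ
    -ᴿ_   : ℝ → ℝ
    0ᴿ    : ℝ
    1ᴿ    : ℝ
    _≤ᴿ_  : ℝ → ℝ → Set
    isCommutativeRing : IsCommutativeRing _≡_ _+ᴿ_ _*ᴿ_ -ᴿ_ 0ᴿ 1ᴿ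
    0≢1   : 0ᴿ ≢ 1ᴿ
    inverse : (x : ℝ) → x ≢ 0ᴿ → Σ ℝ (λ y → x *ᴿ y ≡ 1ᴿ)
    isTotalOrder : IsTotalOrder _≡_ _≤ᴿ_
    +-mono-≤ : ∀ {x y} (z : ℝ) → x ≤ᴿ y → x +ᴿ z ≤ᴿ y +ᴿ z
    *-nonneg : ∀ {x y} → 0ᴿ ≤ᴿ x → 0ᴿ ≤ᴿ y → 0ᴿ ≤ᴿ x *ᴿ y
    sup : (P : ℝ → Set) → ∃ P → ∃ (λ b → ∀ x → P x → x ≤ᴿ b) →
          ∃ (λ s → (∀ x → P x → x ≤ᴿ s) ×
                   (∀ b → (∀ x → P x → x ≤ᴿ b) → s ≤ᴿ b))
    sqrt : ℝ → ℝ
    sqrt-nonneg : ∀ x → 0ᴿ ≤ᴿ sqrt x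
    sqrt-sq : ∀ x → 0ᴿ ≤ᴿ x → sqrt x *ᴿ sqrt x ≡ x

module _ (R : Reals) where
  open Reals R

  dist : ∀ {d} → Vec ℝ d → Vec ℝ d → ℝ
  dist a b = sqrt (foldr _ _+ᴿ_ 0ᴿ
                     (zipWith (λ u v → (u +ᴿ (-ᴿ v)) *ᴿ (u +ᴿ (-ᴿ v))) a b))

-- A coloring of the 2-subsets of [n] is given as a
-- function COL on ordered pairs of (distinct) elements of Fin n (only
-- its values on pairs of distinct elements matter below).
-- A whomog set of size L is a set V ⊆ [n] with |V| = L, listed (in some
-- order) as x₀,…,x_{L-1} — i.e. an injection Fin L → Fin n — such that
-- for every (0-based) i with i + 3 < L (1-based: i ≤ L-3) and all
-- i < j < k, COL(x_i,x_j) = COL(x_i,x_k).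

HasWhomogOfSize : {C : Set} (n : ℕ) (COL : Fin n → Fin n → C) (L : ℕ) → Set
HasWhomogOfSize n COL L =
  Σ (Fin L → Fin n) λ x →
    (∀ i j → x i ≡ x j → i ≡ j) ×
    (∀ (i j k : Fin L) → toℕ i + 3 < L → toℕ i < toℕ j → toℕ j < toℕ k →
       COL (x i) (x j) ≡ COL (x i) (x k))

module Submission where

-- Distinct points P₀,…,P_{d+2} of ℝᵈ cannot be listed so that every Pᵢ
-- with i < d is equidistant from all later points.
--
-- Put c = P_{d+2} and vⱼ = Pⱼ - c.  Expanding |Pᵢ - Pⱼ| = |Pᵢ - c| gives
-- 2⟨vᵢ,vⱼ⟩ = ‖vⱼ‖² for every centre i < d and every j > i: the vⱼ form a
-- "centred chain".  The d+1 vectors v₁,…,v_{d+1} of ℝᵈ are linearly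
-- dependent, Σ αⱼvⱼ = 0 with some αⱼ ≠ 0.  Pairing this relation with the
-- two consecutive centres v₀ and v₁ and subtracting leaves α₁‖v₁‖² = 0, so
-- α₁ = 0 and the chain can be shortened by one.  When a single centre u is
-- left, the relation involves two free vectors x, y only, and pairing it
-- with u, x and y forces x = 0, y = 0 or x = y; all three contradict the
-- distinctness of the points.
--
-- The reals of Defs are an abstract ordered field whose equality is not
-- decidable, so case distinctions are made in the double-negation monad;
-- this is harmless because every goal is a contradiction.

open import Defs
open import Level using (0ℓ)
open import Algebra.Bundles using (CommutativeRing)
open import Data.Nat using (ℕ; zero; suc; _+_; _<_; s≤s; z≤n)
import Data.Nat.Properties as ℕ
open import Data.Fin using (Fin; zero; suc; toℕ; punchIn; inject₁; fromℕ)
  renaming (_≟_ to _≟ᶠ_)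
open import Data.Fin.Properties using
  (suc-injective; toℕ-inject₁; toℕ-fromℕ; toℕ<n; inject₁-injective; fromℕ≢inject₁)
open import Data.Vec using (Vec; []; _∷_; lookup; tabulate; zipWith; foldr)
open import Data.Vec.Properties using (tabulate∘lookup; tabulate-cong)
open import Data.Vec.Functional using (insertAt)
open import Data.Vec.Functional.Properties using (insertAt-lookup; insertAt-punchIn)
open import Data.Product using (Σ; ∃; _×_; _,_)
open import Data.Sum using (_⊎_; inj₁; inj₂)
open import Data.Empty using (⊥; ⊥-elim)
open import Function using (_∘_)
open import Effect.Monad using (RawMonad)
open import Relation.Binary.PropositionalEquality
open import Relation.Binary.Structures using (IsTotalOrder)
open import Relation.Nullary using (¬_; yes; no)
open import Relation.Nullary.Negation using (¬¬-Monad)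
open import Relation.Nullary.Decidable using (¬¬-excluded-middle)

module EuclideanSpace (ℛ : Reals) where
  open Reals ℛ
  open ≡-Reasoning
  open RawMonad (¬¬-Monad {0ℓ}) using (pure; _<$>_; _>>=_)
  open IsTotalOrder isTotalOrder using (total; antisym)
    renaming (trans to ≤-trans; reflexive to ≤-reflexive)

  ℝ-ring : CommutativeRing 0ℓ 0ℓ
  ℝ-ring = record { isCommutativeRing = isCommutativeRing }

  open CommutativeRing ℝ-ring using
    ( +-comm; +-assoc; +-identityˡ; +-identityʳ; -‿inverseˡ; -‿inverseʳ
    ; *-comm; *-assoc; *-identityˡ; zeroˡ; zeroʳ; distribˡ
    ; ring; semiring; commutativeSemiring )
  open import Algebra.Properties.Ring ring using
    ( +-cancelˡ; +-cancelʳ; -‿involutive; -‿distribˡ-*; -‿distribʳ-*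
    ; x[y-z]≈xy-xz; x≈y⇒x∙y⁻¹≈ε; x∙y⁻¹≈ε⇒x≈y; ⁻¹-anti-homo‿- )
  open import Algebra.Properties.Semiring.Sum semiring using
    ( sum; sum-cong-≗; sum-replicate-zero; ∑-distrib-+; ∑-comm
    ; *-distribˡ-sum; *-distribʳ-sum; sum-remove )
  -- Commutative-semiring identities are discharged by the ring solver with
  -- natural-number coefficients; differences are kept as opaque atoms.
  open import Algebra.Solver.Ring.NaturalCoefficients.Default commutativeSemiring
    using (solve; _:+_; _:*_; _:=_)

  infixl 6 _-ᴿ_
  _-ᴿ_ : ℝ → ℝ → ℝ
  x -ᴿ y = x +ᴿ (-ᴿ y)

  private variable
    D n : ℕ

  nonzero-cancel : ∀ {x y} → x ≢ 0ᴿ → x *ᴿ y ≡ 0ᴿ → y ≡ 0ᴿ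
  nonzero-cancel {x} {y} x≢0 xy≡0 with inverse x x≢0
  ... | x⁻¹ , xx⁻¹≡1 = begin
    y                ≡⟨ sym (*-identityˡ y) ⟩
    1ᴿ *ᴿ y          ≡⟨ cong (_*ᴿ y) (trans (sym xx⁻¹≡1) (*-comm x x⁻¹)) ⟩
    (x⁻¹ *ᴿ x) *ᴿ y  ≡⟨ *-assoc x⁻¹ x y ⟩
    x⁻¹ *ᴿ (x *ᴿ y)  ≡⟨ cong (x⁻¹ *ᴿ_) xy≡0 ⟩
    x⁻¹ *ᴿ 0ᴿ        ≡⟨ zeroʳ x⁻¹ ⟩
    0ᴿ               ∎

  nonzero-* : ∀ {x y} → x ≢ 0ᴿ → y ≢ 0ᴿ → x *ᴿ y ≢ 0ᴿ
  nonzero-* x≢0 y≢0 = y≢0 ∘ nonzero-cancel x≢0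

  *-cancel-nonzero : ∀ {x y z} → x ≢ 0ᴿ → x *ᴿ y ≡ x *ᴿ z → y ≡ z
  *-cancel-nonzero {x} {y} {z} x≢0 xy≡xz =
    x∙y⁻¹≈ε⇒x≈y y z (nonzero-cancel x≢0 (trans (x[y-z]≈xy-xz x y z) (x≈y⇒x∙y⁻¹≈ε xy≡xz)))

  1≢0 : 1ᴿ ≢ 0ᴿ
  1≢0 = 0≢1 ∘ sym

  sub-add : ∀ x y → x -ᴿ y +ᴿ y ≡ x
  sub-add x y = begin
    x -ᴿ y +ᴿ y          ≡⟨ +-assoc x (-ᴿ y) y ⟩
    x +ᴿ ((-ᴿ y) +ᴿ y)   ≡⟨ cong (x +ᴿ_) (-‿inverseˡ y) ⟩
    x +ᴿ 0ᴿ              ≡⟨ +-identityʳ x ⟩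
    x                    ∎

  difference-of-differences : ∀ x y z → (x -ᴿ z) -ᴿ (y -ᴿ z) ≡ x -ᴿ y
  difference-of-differences x y z = begin
    (x -ᴿ z) -ᴿ (y -ᴿ z)           ≡⟨ cong ((x -ᴿ z) +ᴿ_) (⁻¹-anti-homo‿- y z) ⟩
    (x -ᴿ z) +ᴿ (z -ᴿ y)           ≡⟨ +-assoc x (-ᴿ z) (z -ᴿ y) ⟩
    x +ᴿ ((-ᴿ z) +ᴿ (z -ᴿ y))      ≡⟨ cong (x +ᴿ_) (sym (+-assoc (-ᴿ z) z (-ᴿ y))) ⟩
    x +ᴿ ((-ᴿ z) +ᴿ z -ᴿ y)        ≡⟨ cong (λ w → x +ᴿ (w -ᴿ y)) (-‿inverseˡ z) ⟩
    x +ᴿ (0ᴿ -ᴿ y)                 ≡⟨ cong (x +ᴿ_) (+-identityˡ (-ᴿ y)) ⟩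
    x -ᴿ y                         ∎

  -- (a - b)² + 2ab = a² + b², proved by writing a as (a - b) + b.
  square-of-difference : ∀ a b → (a -ᴿ b) *ᴿ (a -ᴿ b) +ᴿ (a *ᴿ b +ᴿ a *ᴿ b) ≡ a *ᴿ a +ᴿ b *ᴿ b
  square-of-difference a b =
    subst (λ x → (a -ᴿ b) *ᴿ (a -ᴿ b) +ᴿ (x *ᴿ b +ᴿ x *ᴿ b) ≡ x *ᴿ x +ᴿ b *ᴿ b)
          (sub-add a b) (expansion (a -ᴿ b) b)
    where
    expansion : ∀ e b → e *ᴿ e +ᴿ ((e +ᴿ b) *ᴿ b +ᴿ (e +ᴿ b) *ᴿ b) ≡ (e +ᴿ b) *ᴿ (e +ᴿ b) +ᴿ b *ᴿ b
    expansion = solve 2 (λ e b → e :* e :+ ((e :+ b) :* b :+ (e :+ b) :* b)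
                                  := (e :+ b) :* (e :+ b) :+ b :* b) refl

  ≤-+ʳ : ∀ {b} a → 0ᴿ ≤ᴿ b → a ≤ᴿ a +ᴿ b
  ≤-+ʳ {b} a 0≤b = subst₂ _≤ᴿ_ (+-identityˡ a) (+-comm b a) (+-mono-≤ a 0≤b)

  +-nonneg : ∀ {a b} → 0ᴿ ≤ᴿ a → 0ᴿ ≤ᴿ b → 0ᴿ ≤ᴿ a +ᴿ b
  +-nonneg {a} 0≤a 0≤b = ≤-trans 0≤a (≤-+ʳ a 0≤b)

  +-nonneg-zero : ∀ {a b} → 0ᴿ ≤ᴿ a → 0ᴿ ≤ᴿ b → a +ᴿ b ≡ 0ᴿ → a ≡ 0ᴿ
  +-nonneg-zero {a} 0≤a 0≤b a+b≡0 = antisym (subst (a ≤ᴿ_) a+b≡0 (≤-+ʳ a 0≤b)) 0≤a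

  square-nonneg : ∀ x → 0ᴿ ≤ᴿ x *ᴿ x
  square-nonneg x with total 0ᴿ x
  ... | inj₁ 0≤x = *-nonneg 0≤x 0≤x
  ... | inj₂ x≤0 = subst (0ᴿ ≤ᴿ_) neg-square (*-nonneg 0≤-x 0≤-x)
    where
    0≤-x : 0ᴿ ≤ᴿ -ᴿ x
    0≤-x = subst₂ _≤ᴿ_ (-‿inverseʳ x) (+-identityˡ (-ᴿ x)) (+-mono-≤ (-ᴿ x) x≤0)
    neg-square : (-ᴿ x) *ᴿ (-ᴿ x) ≡ x *ᴿ x
    neg-square = begin
      (-ᴿ x) *ᴿ (-ᴿ x)   ≡⟨ sym (-‿distribˡ-* x (-ᴿ x)) ⟩
      -ᴿ (x *ᴿ (-ᴿ x))   ≡⟨ cong -ᴿ_ (sym (-‿distribʳ-* x x)) ⟩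
      -ᴿ (-ᴿ (x *ᴿ x))   ≡⟨ -‿involutive (x *ᴿ x) ⟩
      x *ᴿ x             ∎

  square-zero : ∀ {x} → x *ᴿ x ≡ 0ᴿ → ¬ ¬ (x ≡ 0ᴿ)
  square-zero x²≡0 x≢0 = x≢0 (nonzero-cancel x≢0 x²≡0)

  sum-zero : {f : Fin n → ℝ} → (∀ i → f i ≡ 0ᴿ) → sum f ≡ 0ᴿ
  sum-zero {n} f≗0 = trans (sum-cong-≗ f≗0) (sum-replicate-zero n)

  sum-nonneg : (f : Fin n → ℝ) → (∀ i → 0ᴿ ≤ᴿ f i) → 0ᴿ ≤ᴿ sum f
  sum-nonneg {zero}  f 0≤f = ≤-reflexive refl
  sum-nonneg {suc n} f 0≤f = +-nonneg (0≤f zero) (sum-nonneg (f ∘ suc) (0≤f ∘ suc))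

  sum-nonneg-zero : (f : Fin n → ℝ) → (∀ i → 0ᴿ ≤ᴿ f i) → sum f ≡ 0ᴿ → ∀ i → f i ≡ 0ᴿ
  sum-nonneg-zero f 0≤f Σf≡0 zero =
    +-nonneg-zero (0≤f zero) (sum-nonneg (f ∘ suc) (0≤f ∘ suc)) Σf≡0
  sum-nonneg-zero f 0≤f Σf≡0 (suc i) =
    sum-nonneg-zero (f ∘ suc) (0≤f ∘ suc)
      (+-nonneg-zero (sum-nonneg (f ∘ suc) (0≤f ∘ suc)) (0≤f zero)
        (trans (+-comm _ (f zero)) Σf≡0)) i

  ¬¬-∀ : {P : Fin n → Set} → (∀ i → ¬ ¬ P i) → ¬ ¬ (∀ i → P i)
  ¬¬-∀ {zero}  _   = pure λ ()
  ¬¬-∀ {suc n} ¬¬P = ¬¬P zero >>= λ P₀ → ¬¬-∀ (¬¬P ∘ suc) >>= λ Pₛ →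
    pure λ { zero → P₀ ; (suc i) → Pₛ i }

  by-cases : {P : Set} → (P → ⊥) → (¬ P → ⊥) → ⊥
  by-cases if-P if-¬P = ¬¬-excluded-middle λ where
    (yes P) → if-P P
    (no ¬P) → if-¬P ¬P

  ¬¬-fails-or-holds : (P : Fin n → Set) → ¬ ¬ ((∃ λ i → ¬ P i) ⊎ (∀ i → P i))
  ¬¬-fails-or-holds P = ¬¬-excluded-middle >>= λ where
    (yes fails) → pure (inj₁ fails)
    (no ¬fails) → inj₂ <$> ¬¬-∀ (λ i ¬Pi → ¬fails (i , ¬Pi))

  ℝ^_ : ℕ → Set
  ℝ^ D = Fin D → ℝ

  0ᵛ : ℝ^ D
  0ᵛ _ = 0ᴿ

  _⊖_ : ℝ^ D → ℝ^ D → ℝ^ D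
  (x ⊖ y) c = x c -ᴿ y c

  ⟨_,_⟩ : ℝ^ D → ℝ^ D → ℝ
  ⟨ x , y ⟩ = sum (λ c → x c *ᴿ y c)

  ‖_‖² : ℝ^ D → ℝ
  ‖ x ‖² = ⟨ x , x ⟩

  ⟨,⟩-comm : (x y : ℝ^ D) → ⟨ x , y ⟩ ≡ ⟨ y , x ⟩
  ⟨,⟩-comm x y = sum-cong-≗ (λ c → *-comm (x c) (y c))

  ‖‖²-cong : {x y : ℝ^ D} → x ≗ y → ‖ x ‖² ≡ ‖ y ‖²
  ‖‖²-cong x≗y = sum-cong-≗ (λ c → cong₂ _*ᴿ_ (x≗y c) (x≗y c))

  ‖‖²-nonneg : (x : ℝ^ D) → 0ᴿ ≤ᴿ ‖ x ‖²
  ‖‖²-nonneg x = sum-nonneg _ (λ c → square-nonneg (x c))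

  ‖‖²-zero : (x : ℝ^ D) → ‖ x ‖² ≡ 0ᴿ → ¬ ¬ (x ≗ 0ᵛ)
  ‖‖²-zero x ‖x‖²≡0 =
    ¬¬-∀ (λ c → square-zero (sum-nonneg-zero _ (λ c → square-nonneg (x c)) ‖x‖²≡0 c))

  ‖‖²-nonzero : {x : ℝ^ D} → ¬ x ≗ 0ᵛ → ‖ x ‖² ≢ 0ᴿ
  ‖‖²-nonzero {x = x} x≢0 ‖x‖²≡0 = ‖‖²-zero x ‖x‖²≡0 x≢0

  polarization : (x y : ℝ^ D) →
    ‖ x ⊖ y ‖² +ᴿ (⟨ x , y ⟩ +ᴿ ⟨ x , y ⟩) ≡ ‖ x ‖² +ᴿ ‖ y ‖²
  polarization x y = begin
    ‖ x ⊖ y ‖² +ᴿ (⟨ x , y ⟩ +ᴿ ⟨ x , y ⟩)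
      ≡⟨ cong (‖ x ⊖ y ‖² +ᴿ_) (sym (∑-distrib-+ xy xy)) ⟩
    ‖ x ⊖ y ‖² +ᴿ sum (λ c → xy c +ᴿ xy c)
      ≡⟨ sym (∑-distrib-+ (λ c → (x ⊖ y) c *ᴿ (x ⊖ y) c) (λ c → xy c +ᴿ xy c)) ⟩
    sum (λ c → (x ⊖ y) c *ᴿ (x ⊖ y) c +ᴿ (xy c +ᴿ xy c))
      ≡⟨ sum-cong-≗ (λ c → square-of-difference (x c) (y c)) ⟩
    sum (λ c → x c *ᴿ x c +ᴿ y c *ᴿ y c)
      ≡⟨ ∑-distrib-+ (λ c → x c *ᴿ x c) (λ c → y c *ᴿ y c) ⟩
    ‖ x ‖² +ᴿ ‖ y ‖² ∎
    where
    xy : ℝ^ _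
    xy c = x c *ᴿ y c

  equidistant-centre : (x y z : ℝ^ D) → ‖ x ⊖ y ‖² ≡ ‖ x ⊖ z ‖² →
    ⟨ x ⊖ z , y ⊖ z ⟩ +ᴿ ⟨ x ⊖ z , y ⊖ z ⟩ ≡ ‖ y ⊖ z ‖²
  equidistant-centre x y z ‖x-y‖≡‖x-z‖ = +-cancelˡ ‖ x ⊖ z ‖² _ _ (begin
    ‖ x ⊖ z ‖² +ᴿ 2⟨x-z,y-z⟩              ≡⟨ cong (_+ᴿ 2⟨x-z,y-z⟩) ‖x-z‖≡‖[x-z]-[y-z]‖ ⟩
    ‖ (x ⊖ z) ⊖ (y ⊖ z) ‖² +ᴿ 2⟨x-z,y-z⟩  ≡⟨ polarization (x ⊖ z) (y ⊖ z) ⟩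
    ‖ x ⊖ z ‖² +ᴿ ‖ y ⊖ z ‖²              ∎)
    where
    2⟨x-z,y-z⟩ = ⟨ x ⊖ z , y ⊖ z ⟩ +ᴿ ⟨ x ⊖ z , y ⊖ z ⟩
    ‖x-z‖≡‖[x-z]-[y-z]‖ : ‖ x ⊖ z ‖² ≡ ‖ (x ⊖ z) ⊖ (y ⊖ z) ‖²
    ‖x-z‖≡‖[x-z]-[y-z]‖ = trans (sym ‖x-y‖≡‖x-z‖)
      (‖‖²-cong (λ c → sym (difference-of-differences (x c) (y c) (z c))))

  IsRelation : (Fin n → ℝ) → (Fin n → ℝ^ D) → Set
  IsRelation {n} a w = ∀ c → sum (λ i → a i *ᴿ w i c) ≡ 0ᴿ

  Dependent : (Fin n → ℝ^ D) → Set
  Dependent {n} w = Σ (Fin n → ℝ) λ a → (∃ λ i → a i ≢ 0ᴿ) × IsRelation a w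

  pairing : {a : Fin n → ℝ} {w : Fin n → ℝ^ D} → IsRelation a w →
    ∀ u → sum (λ i → a i *ᴿ ⟨ u , w i ⟩) ≡ 0ᴿ
  pairing {a = a} {w} rel u = begin
    sum (λ i → a i *ᴿ sum (λ c → u c *ᴿ w i c))
      ≡⟨ sum-cong-≗ (λ i → *-distribˡ-sum (a i) (λ c → u c *ᴿ w i c)) ⟩
    sum (λ i → sum (λ c → a i *ᴿ (u c *ᴿ w i c)))
      ≡⟨ ∑-comm (λ i c → a i *ᴿ (u c *ᴿ w i c)) ⟩
    sum (λ c → sum (λ i → a i *ᴿ (u c *ᴿ w i c)))
      ≡⟨ sum-cong-≗ (λ c → sum-cong-≗ (λ i → swap-factor (a i) (u c) (w i c))) ⟩
    sum (λ c → sum (λ i → u c *ᴿ (a i *ᴿ w i c)))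
      ≡⟨ sum-cong-≗ (λ c → sym (*-distribˡ-sum (u c) (λ i → a i *ᴿ w i c))) ⟩
    sum (λ c → u c *ᴿ sum (λ i → a i *ᴿ w i c))
      ≡⟨ sum-zero (λ c → trans (cong (u c *ᴿ_) (rel c)) (zeroʳ (u c))) ⟩
    0ᴿ ∎
    where
    swap-factor : ∀ a u w → a *ᴿ (u *ᴿ w) ≡ u *ᴿ (a *ᴿ w)
    swap-factor = solve 3 (λ a u w → a :* (u :* w) := u :* (a :* w)) refl

  scaled-zero : ∀ {a} {x : ℝ^ D} → a ≢ 0ᴿ → (∀ c → a *ᴿ x c ≡ 0ᴿ) → x ≗ 0ᵛ
  scaled-zero a≢0 ax≡0 c = nonzero-cancel a≢0 (ax≡0 c)

  extend-by-zero : (w : Fin (suc n) → ℝ^ D) → Dependent (w ∘ suc) → Dependent w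
  extend-by-zero w (a , (i , aᵢ≢0) , rel) =
    (λ { zero → 0ᴿ ; (suc j) → a j }) , (suc i , aᵢ≢0) , λ c → begin
      0ᴿ *ᴿ w zero c +ᴿ rest c  ≡⟨ cong (_+ᴿ rest c) (zeroˡ (w zero c)) ⟩
      0ᴿ +ᴿ rest c              ≡⟨ +-identityˡ (rest c) ⟩
      rest c                    ≡⟨ rel c ⟩
      0ᴿ                        ∎
    where
    rest : Fin _ → ℝ
    rest c = sum (λ j → a j *ᴿ w (suc j) c)

  drop-zero-coefficient : (w : Fin (suc n) → ℝ^ D) (a : Fin (suc n) → ℝ) → a zero ≡ 0ᴿ →
    (∃ λ i → a i ≢ 0ᴿ) → IsRelation a w → Dependent (w ∘ suc)
  drop-zero-coefficient w a a₀≡0 (zero , a₀≢0) rel = ⊥-elim (a₀≢0 a₀≡0)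
  drop-zero-coefficient w a a₀≡0 (suc i , aᵢ≢0) rel = a ∘ suc , (i , aᵢ≢0) , relation
    where
    relation : IsRelation (a ∘ suc) (w ∘ suc)
    relation c = begin
      rest                        ≡⟨ +-identityˡ rest ⟨
      0ᴿ +ᴿ rest                  ≡⟨ cong (_+ᴿ rest) a₀w₀≡0 ⟨
      a zero *ᴿ w zero c +ᴿ rest  ≡⟨ rel c ⟩
      0ᴿ                          ∎
      where
      rest = sum (λ j → a (suc j) *ᴿ w (suc j) c)
      a₀w₀≡0 : a zero *ᴿ w zero c ≡ 0ᴿ
      a₀w₀≡0 = trans (cong (_*ᴿ w zero c) a₀≡0) (zeroˡ (w zero c))

  drop-zero-coordinate : (w : Fin n → ℝ^ suc D) → (∀ i → w i zero ≡ 0ᴿ) →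
    Dependent (λ i → w i ∘ suc) → Dependent w
  drop-zero-coordinate w wᵢ₀≡0 (a , nonzero , rel) = a , nonzero , λ where
    zero    → sum-zero (λ i → trans (cong (a i *ᴿ_) (wᵢ₀≡0 i)) (zeroʳ (a i)))
    (suc c) → rel c

  -- One step of Gaussian elimination: with pivot vₚ (vₚ c₀ ≠ 0), the vectors
  -- vₚ c₀ · vₖ - vₖ c₀ · vₚ (k ≠ p) have vanishing c₀-coordinate …
  eliminate : (v : Fin (suc n) → ℝ^ D) (p : Fin (suc n)) (c₀ : Fin D) → Fin n → ℝ^ D
  eliminate v p c₀ k c = v p c₀ *ᴿ v (punchIn p k) c +ᴿ v (punchIn p k) c₀ *ᴿ (-ᴿ v p c)

  eliminate-pivot-coordinate : (v : Fin (suc n) → ℝ^ D) (p : Fin (suc n)) (c₀ : Fin D) →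
    ∀ k → eliminate v p c₀ k c₀ ≡ 0ᴿ
  eliminate-pivot-coordinate v p c₀ k = begin
    π *ᴿ r +ᴿ r *ᴿ (-ᴿ π)   ≡⟨ cong (π *ᴿ r +ᴿ_) (sym (-‿distribʳ-* r π)) ⟩
    π *ᴿ r -ᴿ r *ᴿ π         ≡⟨ cong (λ t → π *ᴿ r -ᴿ t) (*-comm r π) ⟩
    π *ᴿ r -ᴿ π *ᴿ r         ≡⟨ -‿inverseʳ (π *ᴿ r) ⟩
    0ᴿ                        ∎
    where
    π = v p c₀
    r = v (punchIn p k) c₀

  pivot-lift : (v : Fin (suc n) → ℝ^ D) (p : Fin (suc n)) (c₀ : Fin D) → v p c₀ ≢ 0ᴿ →
    Dependent (eliminate v p c₀) → Dependent v
  pivot-lift {n} v p c₀ π≢0 (a , (i , aᵢ≢0) , rel) =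
    α , (punchIn p i , subst (_≢ 0ᴿ) (sym (insertAt-punchIn scaled p β i)) (nonzero-* π≢0 aᵢ≢0)) ,
    λ c → trans (combination c) (rel c)
    where
    π = v p c₀
    r : Fin n → ℝ^ _
    r k = v (punchIn p k)
    S = sum (λ k → a k *ᴿ r k c₀)
    β = -ᴿ S
    scaled : Fin n → ℝ
    scaled k = π *ᴿ a k
    α = insertAt scaled p β
    regroup : ∀ a π r s t → a *ᴿ (π *ᴿ r +ᴿ s *ᴿ t) ≡ (π *ᴿ a) *ᴿ r +ᴿ (a *ᴿ s) *ᴿ t
    regroup = solve 5 (λ a π r s t → a :* (π :* r :+ s :* t) := (π :* a) :* r :+ (a :* s) :* t) refl
    combination : ∀ c → sum (λ j → α j *ᴿ v j c) ≡ sum (λ k → a k *ᴿ eliminate v p c₀ k c)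
    combination c = begin
      sum (λ j → α j *ᴿ v j c)
        ≡⟨ sum-remove {i = p} (λ j → α j *ᴿ v j c) ⟩
      α p *ᴿ v p c +ᴿ sum (λ k → α (punchIn p k) *ᴿ r k c)
        ≡⟨ cong₂ _+ᴿ_ (cong (_*ᴿ v p c) (insertAt-lookup scaled p β))
                      (sum-cong-≗ (λ k → cong (_*ᴿ r k c) (insertAt-punchIn scaled p β k))) ⟩
      β *ᴿ v p c +ᴿ sum (λ k → scaled k *ᴿ r k c)
        ≡⟨ cong (_+ᴿ sum (λ k → scaled k *ᴿ r k c))
                (trans (sym (-‿distribˡ-* S (v p c))) (-‿distribʳ-* S (v p c))) ⟩
      S *ᴿ (-ᴿ v p c) +ᴿ sum (λ k → scaled k *ᴿ r k c)
        ≡⟨ +-comm _ _ ⟩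
      sum (λ k → scaled k *ᴿ r k c) +ᴿ S *ᴿ (-ᴿ v p c)
        ≡⟨ cong (sum (λ k → scaled k *ᴿ r k c) +ᴿ_)
                (*-distribʳ-sum (-ᴿ v p c) (λ k → a k *ᴿ r k c₀)) ⟩
      sum (λ k → scaled k *ᴿ r k c) +ᴿ sum (λ k → (a k *ᴿ r k c₀) *ᴿ (-ᴿ v p c))
        ≡⟨ sym (∑-distrib-+ (λ k → scaled k *ᴿ r k c) (λ k → (a k *ᴿ r k c₀) *ᴿ (-ᴿ v p c))) ⟩
      sum (λ k → scaled k *ᴿ r k c +ᴿ (a k *ᴿ r k c₀) *ᴿ (-ᴿ v p c))
        ≡⟨ sum-cong-≗ (λ k → sym (regroup (a k) π (r k c) (r k c₀) (-ᴿ v p c))) ⟩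
      sum (λ k → a k *ᴿ eliminate v p c₀ k c) ∎

  -- Any D+1 vectors of ℝᴰ are linearly dependent: eliminate the first
  -- coordinate with a pivot, or drop it if it vanishes throughout.
  D+1-vectors-dependent : ∀ D (v : Fin (suc D) → ℝ^ D) → ¬ ¬ Dependent v
  D+1-vectors-dependent zero    v = pure ((λ _ → 1ᴿ) , (zero , 1≢0) , λ ())
  D+1-vectors-dependent (suc D) v = ¬¬-fails-or-holds (λ i → v i zero ≡ 0ᴿ) >>= λ where
    (inj₁ (p , vₚ₀≢0)) →
      pivot-lift v p zero vₚ₀≢0
        ∘ drop-zero-coordinate (eliminate v p zero) (eliminate-pivot-coordinate v p zero)
        <$> D+1-vectors-dependent D (λ k → eliminate v p zero k ∘ suc)
    (inj₂ vᵢ₀≡0) →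
      extend-by-zero v ∘ drop-zero-coordinate (v ∘ suc) (vᵢ₀≡0 ∘ suc)
        <$> D+1-vectors-dependent D (λ i → v (suc i) ∘ suc)

  -- v₀,…,v_{k+1} form a centred chain with k centres if every centre vᵢ
  -- (i < k) satisfies 2⟨vᵢ,vⱼ⟩ = ‖vⱼ‖² for all later vⱼ.  For vⱼ = Pⱼ - c this
  -- says that Pᵢ is as far from Pⱼ as from c.
  CentredChain : ∀ k → (Fin (suc (suc k)) → ℝ^ D) → Set
  CentredChain k v = ∀ i j → toℕ i < k → toℕ i < toℕ j →
    ⟨ v i , v j ⟩ +ᴿ ⟨ v i , v j ⟩ ≡ ‖ v j ‖²

  Separated : (Fin n → ℝ^ D) → Set
  Separated w = (∀ i → ¬ w i ≗ 0ᵛ) × (∀ i j → i ≢ j → ¬ w i ≗ w j)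

  centre-pairing : {a : Fin n → ℝ} {w : Fin n → ℝ^ D} → IsRelation a w →
    (u : ℝ^ D) (g : Fin n → ℝ) → (∀ i → ⟨ u , w i ⟩ +ᴿ ⟨ u , w i ⟩ ≡ g i) →
    sum (λ i → a i *ᴿ g i) ≡ 0ᴿ
  centre-pairing {a = a} {w} rel u g 2⟨u,w⟩≡g = begin
    sum (λ i → a i *ᴿ g i)
      ≡⟨ sum-cong-≗ (λ i → trans (cong (a i *ᴿ_) (sym (2⟨u,w⟩≡g i))) (distribˡ (a i) (f i) (f i))) ⟩
    sum (λ i → a i *ᴿ f i +ᴿ a i *ᴿ f i)
      ≡⟨ ∑-distrib-+ (λ i → a i *ᴿ f i) (λ i → a i *ᴿ f i) ⟩
    sum (λ i → a i *ᴿ f i) +ᴿ sum (λ i → a i *ᴿ f i)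
      ≡⟨ cong₂ _+ᴿ_ (pairing {a = a} {w} rel u) (pairing {a = a} {w} rel u) ⟩
    0ᴿ +ᴿ 0ᴿ
      ≡⟨ +-identityʳ 0ᴿ ⟩
    0ᴿ ∎
    where
    f : Fin _ → ℝ
    f i = ⟨ u , w i ⟩

  -- Two consecutive centres v₀, v₁ of a chain force the coefficient a₀ of v₁
  -- in any relation among v₁, v₂, … to vanish: pairing with v₀ gives
  -- a₀‖v₁‖² + r = 0 and pairing with v₁ gives 2a₀‖v₁‖² + r = 0, with the same
  -- remainder r = Σ_{j>0} aⱼ‖v_{j+1}‖².
  leading-coefficient-vanishes : ∀ m (v : Fin (suc (suc (suc (suc m)))) → ℝ^ D) →
    CentredChain (suc (suc m)) v → ¬ v (suc zero) ≗ 0ᵛ →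
    {a : Fin (suc (suc (suc m))) → ℝ} → IsRelation a (v ∘ suc) → a zero ≡ 0ᴿ
  leading-coefficient-vanishes m v chain v₁≢0 {a} rel =
    nonzero-cancel (‖‖²-nonzero v₁≢0) (trans (*-comm g₀ (a zero)) a₀g₀≡0)
    where
    g : Fin (suc (suc (suc m))) → ℝ
    g j = ‖ v (suc j) ‖²
    g₀ = g zero
    rest = sum (λ j → a (suc j) *ᴿ g (suc j))
    first-centre : a zero *ᴿ g₀ +ᴿ rest ≡ 0ᴿ
    first-centre = centre-pairing {a = a} {v ∘ suc} rel (v zero) g
      (λ j → chain zero (suc j) (s≤s z≤n) (s≤s z≤n))
    second-centre : a zero *ᴿ (g₀ +ᴿ g₀) +ᴿ rest ≡ 0ᴿ
    second-centre = centre-pairing {a = a} {v ∘ suc} rel (v (suc zero))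
      (λ { zero → g₀ +ᴿ g₀ ; (suc j) → g (suc j) })
      (λ { zero    → refl
         ; (suc j) → chain (suc zero) (suc (suc j)) (s≤s (s≤s z≤n)) (s≤s (s≤s z≤n)) })
    a₀g₀≡0 : a zero *ᴿ g₀ ≡ 0ᴿ
    a₀g₀≡0 = begin
      a zero *ᴿ g₀                          ≡⟨ sym (+-identityʳ _) ⟩
      a zero *ᴿ g₀ +ᴿ 0ᴿ                    ≡⟨ cong (a zero *ᴿ g₀ +ᴿ_) (sym first-centre) ⟩
      a zero *ᴿ g₀ +ᴿ (a zero *ᴿ g₀ +ᴿ rest) ≡⟨ regroup (a zero) g₀ rest ⟩
      a zero *ᴿ (g₀ +ᴿ g₀) +ᴿ rest           ≡⟨ second-centre ⟩
      0ᴿ                                    ∎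
      where
      regroup : ∀ a g r → a *ᴿ g +ᴿ (a *ᴿ g +ᴿ r) ≡ a *ᴿ (g +ᴿ g) +ᴿ r
      regroup = solve 3 (λ a g r → a :* g :+ (a :* g :+ r) := a :* (g :+ g) :+ r) refl

  -- A single centre u with two free vectors x, y: pairing a relation
  -- a₀x + a₁y = 0 with u, x and y gives a₀(‖x‖² - ⟨x,y⟩) = 0 and
  -- a₁(‖y‖² - ⟨x,y⟩) = 0, so x = 0, y = 0 or ‖x - y‖² = 0.
  one-centre : (u : ℝ^ D) (w : Fin 2 → ℝ^ D) →
    (∀ j → ⟨ u , w j ⟩ +ᴿ ⟨ u , w j ⟩ ≡ ‖ w j ‖²) → Separated w → ¬ Dependent w
  one-centre u w centre (nonzero , distinct) (a , (i , aᵢ≢0) , rel) = nonzero-coefficient i aᵢ≢0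
    where
    x = w zero
    y = w (suc zero)
    a₀ = a zero
    a₁ = a (suc zero)
    q = ⟨ x , y ⟩

    -- The three pairings, with the trailing "+ 0" of the sums over Fin 2.
    paired-with-u : a₀ *ᴿ ‖ x ‖² +ᴿ (a₁ *ᴿ ‖ y ‖² +ᴿ 0ᴿ) ≡ 0ᴿ
    paired-with-u = centre-pairing {a = a} {w} rel u (λ j → ‖ w j ‖²) centre
    paired-with-x : a₀ *ᴿ ‖ x ‖² +ᴿ (a₁ *ᴿ q +ᴿ 0ᴿ) ≡ 0ᴿ
    paired-with-x = pairing {a = a} {w} rel x
    paired-with-y : a₀ *ᴿ ⟨ y , x ⟩ +ᴿ (a₁ *ᴿ ‖ y ‖² +ᴿ 0ᴿ) ≡ 0ᴿ
    paired-with-y = pairing {a = a} {w} rel y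

    ‖x‖²≡⟨x,y⟩ : a₀ ≢ 0ᴿ → ‖ x ‖² ≡ q
    ‖x‖²≡⟨x,y⟩ a₀≢0 =
      trans (*-cancel-nonzero a₀≢0 (+-cancelʳ _ _ _ (trans paired-with-u (sym paired-with-y))))
            (⟨,⟩-comm y x)
    ‖y‖²≡⟨x,y⟩ : a₁ ≢ 0ᴿ → ‖ y ‖² ≡ q
    ‖y‖²≡⟨x,y⟩ a₁≢0 =
      *-cancel-nonzero a₁≢0
        (+-cancelʳ _ _ _ (+-cancelˡ _ _ _ (trans paired-with-u (sym paired-with-x))))

    scaled-x : a₁ ≡ 0ᴿ → ∀ c → a₀ *ᴿ x c ≡ 0ᴿ
    scaled-x a₁≡0 c = begin
      a₀ *ᴿ x c                      ≡⟨ sym (+-identityʳ _) ⟩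
      a₀ *ᴿ x c +ᴿ 0ᴿ                ≡⟨ cong (a₀ *ᴿ x c +ᴿ_) (sym (+-identityʳ 0ᴿ)) ⟩
      a₀ *ᴿ x c +ᴿ (0ᴿ +ᴿ 0ᴿ)        ≡⟨ cong (λ t → a₀ *ᴿ x c +ᴿ (t +ᴿ 0ᴿ)) a₁y≡0 ⟨
      a₀ *ᴿ x c +ᴿ (a₁ *ᴿ y c +ᴿ 0ᴿ) ≡⟨ rel c ⟩
      0ᴿ                             ∎
      where a₁y≡0 = trans (cong (_*ᴿ y c) a₁≡0) (zeroˡ (y c))
    scaled-y : a₀ ≡ 0ᴿ → ∀ c → a₁ *ᴿ y c ≡ 0ᴿ
    scaled-y a₀≡0 c = begin
      a₁ *ᴿ y c                      ≡⟨ sym (+-identityʳ _) ⟩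
      a₁ *ᴿ y c +ᴿ 0ᴿ                ≡⟨ sym (+-identityˡ _) ⟩
      0ᴿ +ᴿ (a₁ *ᴿ y c +ᴿ 0ᴿ)        ≡⟨ cong (_+ᴿ (a₁ *ᴿ y c +ᴿ 0ᴿ)) a₀x≡0 ⟨
      a₀ *ᴿ x c +ᴿ (a₁ *ᴿ y c +ᴿ 0ᴿ) ≡⟨ rel c ⟩
      0ᴿ                             ∎
      where a₀x≡0 = trans (cong (_*ᴿ x c) a₀≡0) (zeroˡ (x c))

    only-first : a₁ ≡ 0ᴿ → a₀ ≢ 0ᴿ → ⊥
    only-first a₁≡0 a₀≢0 = nonzero zero (scaled-zero a₀≢0 (scaled-x a₁≡0))
    only-second : a₀ ≡ 0ᴿ → a₁ ≢ 0ᴿ → ⊥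
    only-second a₀≡0 a₁≢0 = nonzero (suc zero) (scaled-zero a₁≢0 (scaled-y a₀≡0))
    both : a₀ ≢ 0ᴿ → a₁ ≢ 0ᴿ → ⊥
    both a₀≢0 a₁≢0 = ‖‖²-zero (x ⊖ y) ‖x-y‖²≡0 λ x-y≗0 →
      distinct zero (suc zero) (λ ()) (λ c → x∙y⁻¹≈ε⇒x≈y (x c) (y c) (x-y≗0 c))
      where
      ‖x-y‖²≡0 : ‖ x ⊖ y ‖² ≡ 0ᴿ
      ‖x-y‖²≡0 = +-cancelʳ (q +ᴿ q) _ _ (begin
        ‖ x ⊖ y ‖² +ᴿ (q +ᴿ q)  ≡⟨ polarization x y ⟩
        ‖ x ‖² +ᴿ ‖ y ‖²        ≡⟨ cong₂ _+ᴿ_ (‖x‖²≡⟨x,y⟩ a₀≢0) (‖y‖²≡⟨x,y⟩ a₁≢0) ⟩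
        q +ᴿ q                  ≡⟨ +-identityˡ (q +ᴿ q) ⟨
        0ᴿ +ᴿ (q +ᴿ q)          ∎)

    nonzero-coefficient : ∀ i → a i ≢ 0ᴿ → ⊥
    nonzero-coefficient zero     a₀≢0 = by-cases (λ a₁≡0 → only-first a₁≡0 a₀≢0) (both a₀≢0)
    nonzero-coefficient (suc zero) a₁≢0 =
      by-cases (λ a₀≡0 → only-second a₀≡0 a₁≢0) (λ a₀≢0 → both a₀≢0 a₁≢0)

  -- The k+1 non-initial vectors of a separated centred chain with k centres
  -- are linearly independent: peel off the leading coefficient while two
  -- centres remain.
  chain-independent : ∀ k (v : Fin (suc (suc k)) → ℝ^ D) →
    CentredChain k v → Separated (v ∘ suc) → ¬ Dependent (v ∘ suc)
  chain-independent zero v _ (nonzero , _) (a , (zero , a₀≢0) , rel) =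
    nonzero zero (scaled-zero a₀≢0 (λ c → trans (sym (+-identityʳ _)) (rel c)))
  chain-independent (suc zero) v chain =
    one-centre (v zero) (v ∘ suc) (λ j → chain zero (suc j) (s≤s z≤n) (s≤s z≤n))
  chain-independent (suc (suc m)) v chain (nonzero , distinct) (a , nz , rel) =
    chain-independent (suc m) (v ∘ suc) tail-chain (nonzero ∘ suc , tail-distinct)
      (drop-zero-coefficient (v ∘ suc) a a₀≡0 nz rel)
    where
    a₀≡0 : a zero ≡ 0ᴿ
    a₀≡0 = leading-coefficient-vanishes m v chain (nonzero zero) {a} rel
    tail-chain : CentredChain (suc m) (v ∘ suc)
    tail-chain i j i<k i<j = chain (suc i) (suc j) (s≤s i<k) (s≤s i<j)
    tail-distinct : ∀ i j → i ≢ j → ¬ v (suc (suc i)) ≗ v (suc (suc j))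
    tail-distinct i j i≢j = distinct (suc i) (suc j) (i≢j ∘ suc-injective)

  -- d+3 distinct points of ℝᵈ listed so that each Qᵢ, i < d, is equidistant
  -- from all later points do not exist: the vectors Qⱼ - Q_{d+2} form a
  -- separated centred chain with d centres, yet d+1 of them lie in ℝᵈ.
  no-equidistant-list : ∀ d (Q : Fin (3 + d) → ℝ^ d) → (∀ i j → i ≢ j → ¬ Q i ≗ Q j) →
    (∀ i j k → toℕ i < d → toℕ i < toℕ j → toℕ j < toℕ k → ‖ Q i ⊖ Q j ‖² ≡ ‖ Q i ⊖ Q k ‖²) → ⊥
  no-equidistant-list d Q distinct equidistant =
    D+1-vectors-dependent d (v ∘ suc) (chain-independent d v chain (nonzero , v-distinct))
    where
    last : Fin (3 + d)
    last = fromℕ (2 + d)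
    v : Fin (2 + d) → ℝ^ d
    v j = Q (inject₁ j) ⊖ Q last
    chain : CentredChain d v
    chain i j i<d i<j = equidistant-centre (Q (inject₁ i)) (Q (inject₁ j)) (Q last)
      (equidistant (inject₁ i) (inject₁ j) last
        (subst (_< d) (sym (toℕ-inject₁ i)) i<d)
        (subst₂ _<_ (sym (toℕ-inject₁ i)) (sym (toℕ-inject₁ j)) i<j)
        (subst₂ _<_ (sym (toℕ-inject₁ j)) (sym (toℕ-fromℕ (2 + d))) (toℕ<n j)))
    v-injective : ∀ {j k} → v j ≗ v k → Q (inject₁ j) ≗ Q (inject₁ k)
    v-injective vⱼ≗vₖ c = +-cancelʳ (-ᴿ Q last c) _ _ (vⱼ≗vₖ c)
    nonzero : ∀ j → ¬ v (suc j) ≗ 0ᵛ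
    nonzero j vⱼ≗0 = distinct (inject₁ (suc j)) last (fromℕ≢inject₁ ∘ sym)
      (λ c → x∙y⁻¹≈ε⇒x≈y _ _ (vⱼ≗0 c))
    v-distinct : ∀ j k → j ≢ k → ¬ v (suc j) ≗ v (suc k)
    v-distinct j k j≢k vⱼ≗vₖ =
      distinct (inject₁ (suc j)) (inject₁ (suc k)) (j≢k ∘ suc-injective ∘ inject₁-injective)
        (v-injective vⱼ≗vₖ)

  dist≡√‖‖² : (x y : Vec ℝ D) → dist ℛ x y ≡ sqrt ‖ lookup x ⊖ lookup y ‖²
  dist≡√‖‖² x y = cong sqrt (fold≡sum x y)
    where
    fold≡sum : ∀ {D} (x y : Vec ℝ D) →
      foldr (λ _ → ℝ) _+ᴿ_ 0ᴿ (zipWith (λ s t → (s -ᴿ t) *ᴿ (s -ᴿ t)) x y)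
        ≡ ‖ lookup x ⊖ lookup y ‖²
    fold≡sum []       []       = refl
    fold≡sum (s ∷ x) (t ∷ y) = cong ((s -ᴿ t) *ᴿ (s -ᴿ t) +ᴿ_) (fold≡sum x y)

  sqrt-injective : ∀ {X Y} → 0ᴿ ≤ᴿ X → 0ᴿ ≤ᴿ Y → sqrt X ≡ sqrt Y → X ≡ Y
  sqrt-injective {X} {Y} 0≤X 0≤Y √X≡√Y = begin
    X                   ≡⟨ sqrt-sq X 0≤X ⟨
    sqrt X *ᴿ sqrt X    ≡⟨ cong₂ _*ᴿ_ √X≡√Y √X≡√Y ⟩
    sqrt Y *ᴿ sqrt Y    ≡⟨ sqrt-sq Y 0≤Y ⟩
    Y                   ∎

  lookup-injective : {x y : Vec ℝ D} → lookup x ≗ lookup y → x ≡ y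
  lookup-injective {x = x} {y} x≗y = begin
    x                    ≡⟨ tabulate∘lookup x ⟨
    tabulate (lookup x)  ≡⟨ tabulate-cong x≗y ⟩
    tabulate (lookup y)  ≡⟨ tabulate∘lookup y ⟩
    y                    ∎

  -- The theorem for whomog sets of size 3 + d (the statement writes d + 3).
  no-whomog : ∀ d n (p : Fin n → Vec ℝ d) → (∀ i j → i ≢ j → p i ≢ p j) →
    ¬ HasWhomogOfSize n (λ i j → dist ℛ (p i) (p j)) (3 + d)
  no-whomog d n p p-distinct (x , x-injective , whomog) =
    no-equidistant-list d Q Q-distinct Q-equidistant
    where
    Q : Fin (3 + d) → ℝ^ d
    Q i = lookup (p (x i))
    Q-distinct : ∀ i j → i ≢ j → ¬ Q i ≗ Q j
    Q-distinct i j i≢j Qᵢ≗Qⱼ with x i ≟ᶠ x j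
    ... | yes xᵢ≡xⱼ = i≢j (x-injective i j xᵢ≡xⱼ)
    ... | no xᵢ≢xⱼ  = p-distinct (x i) (x j) xᵢ≢xⱼ (lookup-injective Qᵢ≗Qⱼ)
    Q-equidistant : ∀ i j k → toℕ i < d → toℕ i < toℕ j → toℕ j < toℕ k →
      ‖ Q i ⊖ Q j ‖² ≡ ‖ Q i ⊖ Q k ‖²
    Q-equidistant i j k i<d i<j j<k =
      sqrt-injective (‖‖²-nonneg (Q i ⊖ Q j)) (‖‖²-nonneg (Q i ⊖ Q k)) (begin
      sqrt ‖ Q i ⊖ Q j ‖²              ≡⟨ dist≡√‖‖² (p (x i)) (p (x j)) ⟨
      dist ℛ (p (x i)) (p (x j))       ≡⟨ whomog i j k centre i<j j<k ⟩
      dist ℛ (p (x i)) (p (x k))       ≡⟨ dist≡√‖‖² (p (x i)) (p (x k)) ⟩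
      sqrt ‖ Q i ⊖ Q k ‖²              ∎)
      where
      centre : toℕ i + 3 < 3 + d
      centre = subst (toℕ i + 3 <_) (ℕ.+-comm d 3) (ℕ.+-monoˡ-< 3 i<d)

mainTheorem7 : (R : Reals) (d n : ℕ) (p : Fin n → Vec (Reals.ℝ R) d) →
    (∀ i j → i ≢ j → p i ≢ p j) →
    ¬ HasWhomogOfSize n (λ i j → dist R (p i) (p j)) (d + 3)
mainTheorem7 R d n p p-distinct =
  EuclideanSpace.no-whomog R d n p p-distinct
    ∘ subst (HasWhomogOfSize n (λ i j → dist R (p i) (p j))) (ℕ.+-comm d 3)
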